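{- For all positive integers $d$ and $p$, the star $K_{1,\binom{d}{p}+1}$ is a minimal forbidden induced subgraph for the class $\mathcal{G}(d,p)=\{G:\Theta_p(G)\le d\}$; that is, $\Theta_p(K_{1,\binom{d}{p}+1})>d$, while $\Theta_p(G)\le d$ for every proper induced subgraph $G$ of $K_{1,\binom{d}{p}+1}$.
   Context: All graphs are finite and simple. For a positive integer $p$, a $p$-intersection representation of a graph $G$ is a map $S:V(G)\to 2^U$ into the subsets of a ground set $U$ such that distinct vertices $u,v$ are adjacent iff $|S(u)\cap S(v)|\ge p$. The $p$-intersection number $\Theta_p(G)$ is the minimum $|U|$ over all such representations. $K_{1,k}$ is the star with one center and $k$ leaves. -}

module Defs where

open import Data.Nat using (ℕ; suc; _≤_; _<_)
open import Data.Fin using (Fin; zero)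
open import Data.Fin.Subset using (Subset; _∩_; ∣_∣)
open import Data.Product using (Σ; _×_)
open import Data.Sum using (_⊎_)
open import Relation.Binary.PropositionalEquality using (_≡_; _≢_)
open import Relation.Nullary using (¬_)
open import Function.Bundles using (_⇔_)
open import Function.Definitions using (Injective)
open import Level using (0ℓ)

record Graph (n : ℕ) : Set₁ where
  field
    Adj    : Fin n → Fin n → Set
    sym    : ∀ {u v} → Adj u v → Adj v u
    irrefl : ∀ {u} → ¬ Adj u u
open Graph public

Rep : ∀ {n} → Graph n → ℕ → ℕ → Set
Rep {n} G p m = Σ (Fin n → Subset m) λ S →
  ∀ (u v : Fin n) → u ≢ v → (Adj G u v ⇔ (p ≤ ∣ S u ∩ S v ∣))

-- Θ_p(G) ≤ d : there is a p-intersection representation with |U| ≤ d.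
ΘLe : ∀ {n} → Graph n → ℕ → ℕ → Set
ΘLe G p d = Σ ℕ λ m → (m ≤ d) × Rep G p m

-- The star K_{1,k}: vertex zero is the centre, the other k vertices are leaves.
StarAdj : ∀ {k} → Fin (suc k) → Fin (suc k) → Set
StarAdj i j = ((i ≡ zero) × (j ≢ zero)) ⊎ ((j ≡ zero) × (i ≢ zero))

Star : (k : ℕ) → Graph (suc k)
Star k = record { Adj = StarAdj ; sym = sw ; irrefl = irr }
  where
  open import Data.Sum using (inj₁; inj₂)
  open import Data.Product using (_,_)
  sw : ∀ {u v} → StarAdj u v → StarAdj v u
  sw (inj₁ (a , b)) = inj₂ (a , b)
  sw (inj₂ (a , b)) = inj₁ (a , b)
  irr : ∀ {u} → ¬ StarAdj u u
  irr (inj₁ (a , b)) = b a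
  irr (inj₂ (a , b)) = b a

Induced : ∀ {m n} → Graph n → (f : Fin m → Fin n) → Injective _≡_ _≡_ f → Graph m
Induced G f inj = record
  { Adj = λ i j → Adj G (f i) (f j)
  ; sym = sym G
  ; irrefl = irrefl G }

module Submission where

-- The star K_{1,k} has Θ_p ≤ m exactly when k ≤ C(m,p): it is governed by the
-- number of p-subsets of an m-set.  Call k pairwise distinct p-subsets of Fin m a
-- p-subset family of size k.
--   * A family of size k represents K_{1,k}: the centre gets the whole ground set and
--     the leaves get the members, since distinct p-sets share fewer than p elements.
--   * Conversely, in a representation of K_{1,k} each leaf shares at least p elements
--     with the centre; choosing p of them per leaf gives a family of size k, because
--     two leaves receiving the same p-set would be adjacent.
--   * A duplicate-free enumeration of the p-subsets of Fin m shows that families have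
--     size at most C(m,p) and that one of size C(m,p) exists.
-- Hence K_{1,C(d,p)+1} is not in G(d,p) (with monotonicity of C(·,p) in the ground set).
-- For minimality, a proper induced subgraph misses a vertex: if it misses the centre it
-- is edgeless, represented by empty sets as p ≥ 1; if it misses a leaf it embeds into
-- K_{1,C(d,p)}, and representations pull back along embeddings.

open import Defs hiding (sym)
open import Data.Nat using (ℕ; zero; suc; _<_; _≤_; _+_; z≤n; s≤s; _≤′_; ≤′-refl; ≤′-step)
open import Data.Nat.Properties
  using ( ≤-refl; ≤-reflexive; ≤-trans; m≤n+m; +-comm; <⇒≱; 1+n≰n; ≤⇒≤′; <-irrefl; suc-injective
        ; module ≤-Reasoning)
open import Data.Nat.Combinatorics using (_C_; nCk+nC[k+1]≡[n+1]C[k+1])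
open import Data.Fin using (Fin; punchOut; _≟_) renaming (zero to fzero; suc to fsuc)
open import Data.Fin.Properties using (punchOut-injective; injective⇒≤; ¬∀⟶∃¬; any?)
  renaming (suc-injective to fsuc-injective)
open import Data.Fin.Subset using (Subset; _∩_; ∣_∣; _⊆_; ⊤; ⊥; inside; outside) renaming (_∈_ to _∈ₛ_)
open import Data.Fin.Subset.Properties
  using (p⊆q⇒∣p∣≤∣q∣; drop-∷-⊆; in⊆in; out⊆; ⊥⊆; ∣⊥∣≡0; p∩q⊆p; p∩q⊆q; x∈p∩q⁺; ∩-identityˡ; ∩-identityʳ)
open import Data.Vec using ([]; _∷_) renaming (here to vhere)
open import Data.Bool using (Bool)
open import Data.List using (List; map; _++_; length; lookup) renaming ([] to []ₗ; _∷_ to _∷ₗ_)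
open import Data.List.Properties using (length-map; length-++)
open import Data.List.Membership.Propositional using (_∈_)
open import Data.List.Membership.Propositional.Properties
  using (∈-map⁺; ∈-map⁻; ∈-++⁺ˡ; ∈-++⁺ʳ; ∈-++⁻; ∈-lookup)
open import Data.List.Relation.Unary.Any as Any using (here)
open import Data.List.Relation.Unary.Any.Properties using (lookup-index)
open import Data.List.Relation.Unary.All as All using () renaming ([] to []ᵃ)
open import Data.List.Relation.Unary.AllPairs using ([]; _∷_)
open import Data.List.Relation.Unary.Unique.Propositional using (Unique)
import Data.List.Relation.Unary.Unique.Propositional.Properties as Unique
open import Data.Product using (Σ; _×_; _,_; proj₁; proj₂; ∃)
import Data.Product as Product
open import Data.Sum using (inj₁; inj₂)
open import Relation.Binary.PropositionalEquality
  using (_≡_; _≢_; refl; sym; trans; cong; cong₂; subst; module ≡-Reasoning)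
open import Relation.Nullary using (¬_)
open import Relation.Nullary.Decidable using (decidable-stable)
open import Relation.Nullary.Negation using (contradiction)
open import Function using (_∘_)
open import Function.Bundles using (_⇔_; mk⇔; Equivalence)
open import Function.Definitions using (Injective)
open import Function.Construct.Composition using (_⇔-∘_)
open import Function.Construct.Symmetry using (⇔-sym)
open Equivalence using (to; from)

subset-of-size : ∀ {m} (T : Subset m) p → p ≤ ∣ T ∣ → Σ (Subset m) λ U → U ⊆ T × ∣ U ∣ ≡ p
subset-of-size {m} T zero _ = ⊥ , ⊥⊆ , ∣⊥∣≡0 m
subset-of-size (inside ∷ T) (suc p) (s≤s p≤∣T∣) with subset-of-size T p p≤∣T∣
... | U , U⊆T , ∣U∣≡p = inside ∷ U , in⊆in U⊆T , cong suc ∣U∣≡p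
subset-of-size (outside ∷ T) (suc p) p≤∣T∣ with subset-of-size T (suc p) p≤∣T∣
... | U , U⊆T , ∣U∣≡p = outside ∷ U , out⊆ U⊆T , ∣U∣≡p

⊆-size-≡ : ∀ {m} {X A : Subset m} → X ⊆ A → ∣ A ∣ ≤ ∣ X ∣ → X ≡ A
⊆-size-≡ {X = []} {[]} _ _ = refl
⊆-size-≡ {X = inside ∷ X} {inside ∷ A} X⊆A (s≤s h) = cong (inside ∷_) (⊆-size-≡ (drop-∷-⊆ X⊆A) h)
⊆-size-≡ {X = outside ∷ X} {outside ∷ A} X⊆A h = cong (outside ∷_) (⊆-size-≡ (drop-∷-⊆ X⊆A) h)
⊆-size-≡ {X = inside ∷ X} {outside ∷ A} X⊆A _ with X⊆A vhere
... | ()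
⊆-size-≡ {X = outside ∷ X} {inside ∷ A} X⊆A h =
  contradiction (≤-trans h (p⊆q⇒∣p∣≤∣q∣ (drop-∷-⊆ X⊆A))) (<-irrefl refl)

-- Two p-sets sharing at least p elements coincide (both equal their intersection).
p-sets-sharing-p-≡ : ∀ {m p} {A B : Subset m} → ∣ A ∣ ≡ p → ∣ B ∣ ≡ p → p ≤ ∣ A ∩ B ∣ → A ≡ B
p-sets-sharing-p-≡ {A = A} {B} ∣A∣≡p ∣B∣≡p shared =
  trans (sym (⊆-size-≡ (p∩q⊆p A B) (subst (_≤ ∣ A ∩ B ∣) (sym ∣A∣≡p) shared)))
        (⊆-size-≡ (p∩q⊆q A B) (subst (_≤ ∣ A ∩ B ∣) (sym ∣B∣≡p) shared))

subsetsOfSize : (m k : ℕ) → List (Subset m)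
subsetsOfSize zero zero = [] ∷ₗ []ₗ
subsetsOfSize zero (suc k) = []ₗ
subsetsOfSize (suc m) zero = map (outside ∷_) (subsetsOfSize m zero)
subsetsOfSize (suc m) (suc k) =
  map (inside ∷_) (subsetsOfSize m k) ++ map (outside ∷_) (subsetsOfSize m (suc k))

subsetsOfSize-length : ∀ m k → length (subsetsOfSize m k) ≡ m C k
subsetsOfSize-length zero zero = refl
subsetsOfSize-length zero (suc k) = refl
subsetsOfSize-length (suc m) zero =
  trans (length-map _ (subsetsOfSize m zero)) (subsetsOfSize-length m zero)
subsetsOfSize-length (suc m) (suc k) = begin
  length (map (inside ∷_) (subsetsOfSize m k) ++ map (outside ∷_) (subsetsOfSize m (suc k)))
    ≡⟨ length-++ (map (inside ∷_) (subsetsOfSize m k)) ⟩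
  length (map (inside ∷_) (subsetsOfSize m k)) + length (map (outside ∷_) (subsetsOfSize m (suc k)))
    ≡⟨ cong₂ _+_ (length-map _ (subsetsOfSize m k)) (length-map _ (subsetsOfSize m (suc k))) ⟩
  length (subsetsOfSize m k) + length (subsetsOfSize m (suc k))
    ≡⟨ cong₂ _+_ (subsetsOfSize-length m k) (subsetsOfSize-length m (suc k)) ⟩
  m C k + m C suc k
    ≡⟨ nCk+nC[k+1]≡[n+1]C[k+1] m k ⟩
  suc m C suc k ∎
  where open ≡-Reasoning

∈subsetsOfSize⇒size : ∀ m k {A} → A ∈ subsetsOfSize m k → ∣ A ∣ ≡ k
∈subsetsOfSize⇒size zero zero (here refl) = refl
∈subsetsOfSize⇒size (suc m) zero A∈ with ∈-map⁻ (outside ∷_) A∈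
... | _ , B∈ , refl = ∈subsetsOfSize⇒size m zero B∈
∈subsetsOfSize⇒size (suc m) (suc k) A∈ with ∈-++⁻ (map (inside ∷_) (subsetsOfSize m k)) A∈
... | inj₁ A∈ins with ∈-map⁻ (inside ∷_) A∈ins
...   | _ , B∈ , refl = cong suc (∈subsetsOfSize⇒size m k B∈)
∈subsetsOfSize⇒size (suc m) (suc k) A∈ | inj₂ A∈outs with ∈-map⁻ (outside ∷_) A∈outs
...   | _ , B∈ , refl = ∈subsetsOfSize⇒size m (suc k) B∈

size⇒∈subsetsOfSize : ∀ {m} (A : Subset m) k → ∣ A ∣ ≡ k → A ∈ subsetsOfSize m k
size⇒∈subsetsOfSize [] zero _ = here refl
size⇒∈subsetsOfSize (inside ∷ A) (suc k) ∣A∣≡k =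
  ∈-++⁺ˡ (∈-map⁺ (inside ∷_) (size⇒∈subsetsOfSize A k (suc-injective ∣A∣≡k)))
size⇒∈subsetsOfSize (outside ∷ A) zero ∣A∣≡k =
  ∈-map⁺ (outside ∷_) (size⇒∈subsetsOfSize A zero ∣A∣≡k)
size⇒∈subsetsOfSize (outside ∷ A) (suc k) ∣A∣≡k =
  ∈-++⁺ʳ (map (inside ∷_) (subsetsOfSize _ k))
         (∈-map⁺ (outside ∷_) (size⇒∈subsetsOfSize A (suc k) ∣A∣≡k))

∷-injectiveʳ : ∀ {m} {x : Bool} {A B : Subset m} → x ∷ A ≡ x ∷ B → A ≡ B
∷-injectiveʳ refl = refl

subsetsOfSize-unique : ∀ m k → Unique (subsetsOfSize m k)
subsetsOfSize-unique zero zero = []ᵃ ∷ []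
subsetsOfSize-unique zero (suc k) = []
subsetsOfSize-unique (suc m) zero = Unique.map⁺ ∷-injectiveʳ (subsetsOfSize-unique m zero)
subsetsOfSize-unique (suc m) (suc k) =
  Unique.++⁺ (Unique.map⁺ ∷-injectiveʳ (subsetsOfSize-unique m k))
             (Unique.map⁺ ∷-injectiveʳ (subsetsOfSize-unique m (suc k))) disjoint
  where
  disjoint : ∀ {A} → ¬ (A ∈ map (inside ∷_) (subsetsOfSize m k)
                      × A ∈ map (outside ∷_) (subsetsOfSize m (suc k)))
  disjoint (A∈ins , A∈outs) with ∈-map⁻ (inside ∷_) A∈ins | ∈-map⁻ (outside ∷_) A∈outs
  ... | _ , _ , refl | _ , _ , ()

lookup-injective : ∀ {A : Set} {xs : List A} → Unique xs → Injective _≡_ _≡_ (lookup xs)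
lookup-injective (_ ∷ _) {fzero} {fzero} _ = refl
lookup-injective (x∉xs ∷ _) {fzero} {fsuc j} e = contradiction e (All.lookup x∉xs (∈-lookup j))
lookup-injective (x∉xs ∷ _) {fsuc i} {fzero} e = contradiction (sym e) (All.lookup x∉xs (∈-lookup i))
lookup-injective (_ ∷ xs-unique) {fsuc i} {fsuc j} e = cong fsuc (lookup-injective xs-unique e)

PSubsetFamily : ℕ → ℕ → ℕ → Set
PSubsetFamily m p k = Σ (Fin k → Subset m) λ T → Injective _≡_ _≡_ T × (∀ i → ∣ T i ∣ ≡ p)

-- A family injects into the enumeration (by position), so it has at most C(m,p) members.
family-bound : ∀ {m p k} → PSubsetFamily m p k → k ≤ m C p
family-bound {m} {p} (T , T-injective , T-size) =
  subst (_ ≤_) (subsetsOfSize-length m p) (injective⇒≤ position-injective)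
  where
  position : ∀ i → T i ∈ subsetsOfSize m p
  position i = size⇒∈subsetsOfSize (T i) p (T-size i)

  position-injective : Injective _≡_ _≡_ (Any.index ∘ position)
  position-injective {i} {j} e =
    T-injective (begin
      T i                                      ≡⟨ lookup-index (position i) ⟩
      lookup L (Any.index (position i))        ≡⟨ cong (lookup L) e ⟩
      lookup L (Any.index (position j))        ≡⟨ lookup-index (position j) ⟨
      T j                                      ∎)
    where
    L : List (Subset m)
    L = subsetsOfSize m p
    open ≡-Reasoning

family-exists : ∀ m p → PSubsetFamily m p (m C p)
family-exists m p = subst (PSubsetFamily m p) (subsetsOfSize-length m p)
  ( lookup (subsetsOfSize m p)
  , lookup-injective (subsetsOfSize-unique m p)
  , λ i → ∈subsetsOfSize⇒size m p (∈-lookup i))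

C-step : ∀ n k → n C k ≤ suc n C k
C-step n zero = ≤-refl
C-step n (suc k) = subst (n C suc k ≤_) (nCk+nC[k+1]≡[n+1]C[k+1] n k) (m≤n+m _ _)

C-mono : ∀ {m n} k → m ≤ n → m C k ≤ n C k
C-mono {m} k = mono′ ∘ ≤⇒≤′
  where
  mono′ : ∀ {n} → m ≤′ n → m C k ≤ n C k
  mono′ ≤′-refl = ≤-refl
  mono′ (≤′-step h) = ≤-trans (mono′ h) (C-step _ k)

leaves-nonadjacent : ∀ {k} {i j : Fin k} → ¬ StarAdj (fsuc i) (fsuc j)
leaves-nonadjacent (inj₁ (() , _))
leaves-nonadjacent (inj₂ (() , _))

family⇒star-rep : ∀ {m p k} → PSubsetFamily m p k → Rep (Star k) p m
family⇒star-rep {m} {p} {k} (T , T-injective , T-size) = S , correct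
  where
  S : Fin (suc k) → Subset m
  S fzero = ⊤
  S (fsuc j) = T j

  correct : ∀ u v → u ≢ v → StarAdj u v ⇔ (p ≤ ∣ S u ∩ S v ∣)
  correct fzero fzero u≢v = contradiction refl u≢v
  correct fzero (fsuc j) _ =
    mk⇔ (λ _ → ≤-reflexive (sym (trans (cong ∣_∣ (∩-identityˡ (T j))) (T-size j))))
        (λ _ → inj₁ (refl , λ ()))
  correct (fsuc i) fzero _ =
    mk⇔ (λ _ → ≤-reflexive (sym (trans (cong ∣_∣ (∩-identityʳ (T i))) (T-size i))))
        (λ _ → inj₂ (refl , λ ()))
  correct (fsuc i) (fsuc j) i≢j =
    mk⇔ (λ adjacent → contradiction adjacent leaves-nonadjacent)
        (λ shared → contradiction
          (cong fsuc (T-injective (p-sets-sharing-p-≡ (T-size i) (T-size j) shared))) i≢j)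

-- Each leaf gets p of the elements it shares with the centre; equal choices would make
-- the two leaves adjacent, so the choices form a family of size k.
star-rep⇒family : ∀ {m p k} → Rep (Star k) p m → PSubsetFamily m p k
star-rep⇒family {m} {p} {k} (S , rep) = U , U-injective , U-size
  where
  shares-with-centre : ∀ j → p ≤ ∣ S fzero ∩ S (fsuc j) ∣
  shares-with-centre j = to (rep fzero (fsuc j) (λ ())) (inj₁ (refl , λ ()))

  choice : ∀ j → Σ (Subset m) λ U → U ⊆ S fzero ∩ S (fsuc j) × ∣ U ∣ ≡ p
  choice j = subset-of-size _ p (shares-with-centre j)

  U : Fin k → Subset m
  U = proj₁ ∘ choice

  U-size : ∀ j → ∣ U j ∣ ≡ p
  U-size = proj₂ ∘ proj₂ ∘ choice

  U⊆leaf : ∀ j → U j ⊆ S (fsuc j)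
  U⊆leaf j = p∩q⊆q (S fzero) (S (fsuc j)) ∘ proj₁ (proj₂ (choice j))

  U-injective : Injective _≡_ _≡_ U
  U-injective {i} {j} Ui≡Uj = decidable-stable (i ≟ j) λ i≢j →
    leaves-nonadjacent (from (rep (fsuc i) (fsuc j) (i≢j ∘ fsuc-injective)) shared)
    where
    shared : p ≤ ∣ S (fsuc i) ∩ S (fsuc j) ∣
    shared = subst (_≤ _) (U-size i) (p⊆q⇒∣p∣≤∣q∣ λ x∈Ui →
      x∈p∩q⁺ (U⊆leaf i x∈Ui , U⊆leaf j (subst (_ ∈ₛ_) Ui≡Uj x∈Ui)))

rep-pullback : ∀ {n n′ p m} {G : Graph n} {H : Graph n′} (g : Fin n → Fin n′) →
  Injective _≡_ _≡_ g → (∀ u v → u ≢ v → Adj G u v ⇔ Adj H (g u) (g v)) →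
  Rep H p m → Rep G p m
rep-pullback g g-injective g-adj (S , rep) =
  S ∘ g , λ u v u≢v → rep (g u) (g v) (u≢v ∘ g-injective) ⇔-∘ g-adj u v u≢v

edgeless-rep : ∀ {n p} {G : Graph n} → 1 ≤ p → (∀ u v → ¬ Adj G u v) → Rep G p 0
edgeless-rep 1≤p no-edge =
  (λ _ → []) , λ u v _ → mk⇔ (λ uv → contradiction uv (no-edge u v))
                               (λ p≤0 → contradiction (≤-trans 1≤p p≤0) λ ())

missed-point : ∀ {a b} {f : Fin a → Fin b} → Injective _≡_ _≡_ f → a < b → ∃ λ w → ∀ i → f i ≢ w
missed-point {a} {b} {f} f-injective a<b =
  Product.map₂ (λ w-missed i fi≡w → w-missed (i , fi≡w))
    (¬∀⟶∃¬ b _ (λ w → any? (λ i → f i ≟ w)) not-surjective)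
  where
  -- a section of a surjection is injective, forcing b ≤ a
  not-surjective : ¬ (∀ w → ∃ λ i → f i ≡ w)
  not-surjective surjective = <⇒≱ a<b (injective⇒≤ section-injective)
    where
    section-injective : Injective _≡_ _≡_ (proj₁ ∘ surjective)
    section-injective {w} {w′} e =
      trans (sym (proj₂ (surjective w))) (trans (cong f e) (proj₂ (surjective w′)))

star-adj-transfer : ∀ {k k′} {u v : Fin (suc k)} {u′ v′ : Fin (suc k′)} →
  (u ≡ fzero ⇔ u′ ≡ fzero) → (v ≡ fzero ⇔ v′ ≡ fzero) → StarAdj u v ⇔ StarAdj u′ v′
star-adj-transfer U V = mk⇔ (transfer U V) (transfer (⇔-sym U) (⇔-sym V))
  where
  transfer : ∀ {k k′} {u v : Fin (suc k)} {u′ v′ : Fin (suc k′)} →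
    (u ≡ fzero ⇔ u′ ≡ fzero) → (v ≡ fzero ⇔ v′ ≡ fzero) → StarAdj u v → StarAdj u′ v′
  transfer U V (inj₁ (u≡0 , v≢0)) = inj₁ (to U u≡0 , v≢0 ∘ from V)
  transfer U V (inj₂ (v≡0 , u≢0)) = inj₂ (to V v≡0 , u≢0 ∘ from U)

punchOut-centre : ∀ {k} {l : Fin (suc k)} {u : Fin (suc (suc k))} (l≢u : fsuc l ≢ u) →
  u ≡ fzero ⇔ punchOut l≢u ≡ fzero
punchOut-centre {u = fzero} _ = mk⇔ (λ _ → refl) (λ _ → refl)
punchOut-centre {u = fsuc _} _ = mk⇔ (λ ()) (λ ())

ProperInducedSubgraphsWithin : ∀ {n} → Graph n → ℕ → ℕ → Set
ProperInducedSubgraphsWithin {n} G p d =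
  ∀ (m : ℕ) (f : Fin m → Fin n) (inj : Injective _≡_ _≡_ f) → m < n → ΘLe (Induced G f inj) p d

-- If K_{1,k} lies in G(d,p) (and p ≥ 1), every proper induced subgraph of K_{1,k+1} does:
-- without the centre it is edgeless, without a leaf it embeds into K_{1,k}.
star-proper-subgraphs : ∀ {k p d} → 1 ≤ p → ΘLe (Star k) p d →
  ProperInducedSubgraphsWithin (Star (suc k)) p d
star-proper-subgraphs {k} 1≤p (s , s≤d , star-rep) m f f-injective m<n
  with missed-point f-injective m<n
... | fzero , centre-missed =
  0 , z≤n , edgeless-rep {G = Induced (Star (suc k)) f f-injective} 1≤p leaves-only
  where
  leaves-only : ∀ i j → ¬ StarAdj (f i) (f j)
  leaves-only i _ (inj₁ (fi≡0 , _)) = centre-missed i fi≡0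
  leaves-only _ j (inj₂ (fj≡0 , _)) = centre-missed j fj≡0
... | fsuc l , leaf-missed =
  s , s≤d , rep-pullback {G = Induced (Star (suc k)) f f-injective} {H = Star k}
                         g g-injective g-adj star-rep
  where
  g : Fin m → Fin (suc k)
  g i = punchOut (leaf-missed i ∘ sym)

  g-injective : Injective _≡_ _≡_ g
  g-injective {i} {j} =
    f-injective ∘ punchOut-injective {i = fsuc l} (leaf-missed i ∘ sym) (leaf-missed j ∘ sym)

  g-adj : ∀ i j → i ≢ j → StarAdj (f i) (f j) ⇔ StarAdj (g i) (g j)
  g-adj i j _ = star-adj-transfer (punchOut-centre _) (punchOut-centre _)

theorem2 : (d p : ℕ) → 1 ≤ d → 1 ≤ p →
    ¬ ΘLe (Star ((d C p) + 1)) p d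
    × (∀ (m : ℕ) (f : Fin m → Fin (suc ((d C p) + 1))) (inj : Injective _≡_ _≡_ f) →
    m < suc ((d C p) + 1) → ΘLe (Induced (Star ((d C p) + 1)) f inj) p d)
theorem2 d p _ 1≤p = star-excluded , star-minimal
  where
  -- a representation over m ≤ d would give C(d,p)+1 distinct p-subsets of Fin m
  star-excluded : ¬ ΘLe (Star ((d C p) + 1)) p d
  star-excluded (m , m≤d , rep) = 1+n≰n (begin
    suc (d C p)  ≡⟨ +-comm 1 (d C p) ⟩
    d C p + 1    ≤⟨ family-bound (star-rep⇒family rep) ⟩
    m C p        ≤⟨ C-mono p m≤d ⟩
    d C p        ∎)
    where open ≤-Reasoning

  -- K_{1,C(d,p)} is represented by all p-subsets of Fin d
  star-minimal : ProperInducedSubgraphsWithin (Star ((d C p) + 1)) p d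
  star-minimal = subst (λ k → ProperInducedSubgraphsWithin (Star k) p d) (+-comm 1 (d C p))
    (star-proper-subgraphs 1≤p (d , ≤-refl , family⇒star-rep (family-exists d p)))
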